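{- Let $n\ge 1$ and let $Q_n$ be the $n$-dimensional hypercube graph with vertex set $\{0,1\}^n$, two vertices being adjacent iff they differ in exactly one coordinate, and regard each edge as a resistor of resistance $1$. For $0\le k\le n$, let $R_{n,k}$ denote the effective resistance between two vertices of $Q_n$ at Hamming distance $k$ (this depends only on $k$). Then $$R_{n,k} = \frac{2}{n}\sum_{j=0}^{k-1} \frac{1}{\binom{n-1}{j}}\cdot \frac{1}{2^n}\sum_{i=j+1}^{n}\binom{n}{i}.$$
   Context: Effective resistance between vertices $u,v$ of a network of unit resistors: the potential difference between $u$ and $v$ when a unit current is injected at $u$ and extracted at $v$ (equivalently, $(e_u-e_v)^T L^{+}(e_u-e_v)$ with $L$ the graph Laplacian). For $k=0$ the sum is empty and $R_{n,0}=0$. -}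

module Defs where

open import Data.Bool using (Bool; true; false; not; if_then_else_; _xor_)
open import Data.Nat using (ℕ; zero; suc; _∸_; _^_) renaming (_+_ to _+ℕ_)
open import Data.Nat.Combinatorics using (_C_)
open import Data.Fin using (Fin)
open import Data.Vec using (Vec; updateAt; zipWith; toList)
open import Data.Vec.Properties using (≡-dec)
open import Data.List using (List; map; foldr; upTo; allFin)
open import Data.Integer using (+_)
open import Data.Rational using (ℚ; 0ℚ; 1ℚ; _+_; _-_; _*_; _/_)
import Data.Bool.Properties as BoolP
open import Relation.Nullary using (does)

Vertex : ℕ → Set
Vertex n = Vec Bool n

flipAt : ∀ {n} → Fin n → Vertex n → Vertex n
flipAt i x = updateAt x i not

ℕtoℚ : ℕ → ℚ
ℕtoℚ m = (+ m) / 1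

hamming : ∀ {n} → Vertex n → Vertex n → ℕ
hamming x y = foldr _+ℕ_ 0 (toList (zipWith (λ a b → if a xor b then 1 else 0) x y))

Σℚ : List ℚ → ℚ
Σℚ = foldr _+_ 0ℚ

-- reciprocal of a natural number (only ever applied to nonzero arguments below)
inv : ℕ → ℚ
inv zero = 0ℚ
inv (suc m) = (+ 1) / suc m

δ : ∀ {n} → Vertex n → Vertex n → ℚ
δ u x = if does (≡-dec BoolP._≟_ u x) then 1ℚ else 0ℚ

laplacian : ∀ n → (Vertex n → ℚ) → Vertex n → ℚ
laplacian n φ x = ℕtoℚ n * φ x - Σℚ (map (λ i → φ (flipAt i x)) (allFin n))

-- φ is a potential for unit current injected at u and extracted at v
IsUnitPotential : ∀ n → Vertex n → Vertex n → (Vertex n → ℚ) → Set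
IsUnitPotential n u v φ = ∀ x → laplacian n φ x ≡ δ u x - δ v x
  where open import Relation.Binary.PropositionalEquality using (_≡_)

-- effective resistance between u and v equals r:
-- a unit-current potential exists, and every such potential has
-- potential difference φ(u) - φ(v) = r
open import Relation.Binary.PropositionalEquality using (_≡_)
open import Data.Product using (Σ; _×_)

EffRes : ∀ n → Vertex n → Vertex n → ℚ → Set
EffRes n u v r =
  Σ (Vertex n → ℚ) (IsUnitPotential n u v) ×
  (∀ φ → IsUnitPotential n u v φ → φ u - φ v ≡ r)

formula : ℕ → ℕ → ℚ
formula n k =
  ℕtoℚ 2 * inv n *
  Σℚ (map (λ j → inv ((n ∸ 1) C j) * inv (2 ^ n) *
               Σℚ (map (λ t → ℕtoℚ (n C (suc j +ℕ t))) (upTo (n ∸ j))))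
          (upTo k))

-- Let P(m) = Σ_{j<m} a_j with a_j = 2⁻ⁿ (Σ_{i>j} C(n,i)) / C(n-1,j). At a vertex at distance m
-- from u the Laplacian of x ↦ P(d(u,x)) is n P(m) − m P(m-1) − (n-m) P(m+1) = m a_{m-1} − (n-m) a_m,
-- and by m C(n,m) = n C(n-1,m-1) and (n-m) C(n,m) = n C(n-1,m) this is
-- n 2⁻ⁿ (Σ_{i≥m} C(n,i) − Σ_{i>m} C(n,i)) / C(n,m) = n 2⁻ⁿ for m ≥ 1, while at m = 0 it is
-- −n a₀ = n (2⁻ⁿ − 1) by the binomial theorem. Hence (P∘d_v − P∘d_u)/n is a unit-current
-- potential from u to v, with drop (2/n) P(d(u,v)). Two unit-current potentials differ by a
-- harmonic function, which is constant on the connected cube by the maximum principle.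
module Submission where

open import Defs
open import Data.Nat using (ℕ; _≤_)
open import Relation.Binary.PropositionalEquality using (_≡_)

open import Algebra.Properties.Group using (x∙y⁻¹≈ε⇒x≈y)
open import Data.Bool using (true; false; not)
import Data.Bool.Properties as Bool
open import Data.Empty using (⊥-elim)
open import Data.Fin using (Fin) renaming (zero to fzero; suc to fsuc)
open import Data.Integer using () renaming (+_ to +ℤ_)
import Data.Integer as ℤ
import Data.Integer.Properties as ℤ
open import Data.List using ([]; _∷_; map; upTo; applyUpTo; allFin)
import Data.List.Properties as List
open import Data.Nat using (zero; suc; pred; _∸_; _^_; _<_; z≤n; s≤s; s≤s⁻¹; ≢-nonZero⁻¹)
  renaming (_+_ to _+ℕ_; _*_ to _*ℕ_)
import Data.Nat.Properties as ℕ
open import Data.Nat.Tactic.RingSolver using (solve-∀)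
open import Data.Nat.Combinatorics using (_C_; nCk+nC[k+1]≡[n+1]C[k+1]; nC1≡n)
open import Data.Nat.Combinatorics.Specification using (k>n⇒nCk≡0)
open import Data.Nat.Coprimality using (1-coprimeTo) renaming (sym to coprime-sym)
open import Data.Product using (Σ-syntax; _,_; proj₁; proj₂)
open import Data.Rational using (ℚ; 0ℚ; 1ℚ; _+_; _-_; _*_; mkℚ; _/_)
  renaming (_≤_ to _≤ℚ_)
import Data.Rational.Properties as ℚ
open import Data.Rational.Solver using (module +-*-Solver)
open import Data.Sum using (inj₁; inj₂)
open import Data.Vec using ([]; _∷_)
open import Data.Vec.Properties using (≡-dec)
open import Relation.Binary.PropositionalEquality
  using (_≢_; refl; sym; trans; cong; cong₂; module ≡-Reasoning)
open import Relation.Nullary using (yes; no)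

open +-*-Solver using (solve; _:+_; _:*_; _:-_; _:=_; con)

ℕtoℚ≡mkℚ : ∀ m → ℕtoℚ m ≡ mkℚ (+ℤ m) 0 (coprime-sym (1-coprimeTo m))
ℕtoℚ≡mkℚ m = ℚ.normalize-coprime (coprime-sym (1-coprimeTo m))

inv≡mkℚ : ∀ m → inv (suc m) ≡ mkℚ (+ℤ 1) m (1-coprimeTo (suc m))
inv≡mkℚ m = ℚ.normalize-coprime (1-coprimeTo (suc m))

ℕtoℚ-suc : ∀ m → ℕtoℚ (suc m) ≡ 1ℚ + ℕtoℚ m
ℕtoℚ-suc m rewrite ℕtoℚ≡mkℚ m =
  cong (λ z → (+ℤ 1 ℤ.+ z) / 1) (trans (cong +ℤ_ (sym (ℕ.*-identityʳ m))) (sym (ℤ.+◃n≡+n (m *ℕ 1))))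

ℕtoℚ-+ : ∀ a b → ℕtoℚ (a +ℕ b) ≡ ℕtoℚ a + ℕtoℚ b
ℕtoℚ-+ zero    b = sym (ℚ.+-identityˡ (ℕtoℚ b))
ℕtoℚ-+ (suc a) b = begin
  ℕtoℚ (suc (a +ℕ b))     ≡⟨ ℕtoℚ-suc (a +ℕ b) ⟩
  1ℚ + ℕtoℚ (a +ℕ b)      ≡⟨ cong (1ℚ +_) (ℕtoℚ-+ a b) ⟩
  1ℚ + (ℕtoℚ a + ℕtoℚ b)  ≡⟨ ℚ.+-assoc 1ℚ (ℕtoℚ a) (ℕtoℚ b) ⟨
  1ℚ + ℕtoℚ a + ℕtoℚ b    ≡⟨ cong (_+ ℕtoℚ b) (ℕtoℚ-suc a) ⟨
  ℕtoℚ (suc a) + ℕtoℚ b   ∎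
  where open ≡-Reasoning

ℕtoℚ-* : ∀ a b → ℕtoℚ (a *ℕ b) ≡ ℕtoℚ a * ℕtoℚ b
ℕtoℚ-* zero    b = sym (ℚ.*-zeroˡ (ℕtoℚ b))
ℕtoℚ-* (suc a) b = begin
  ℕtoℚ (b +ℕ a *ℕ b)          ≡⟨ ℕtoℚ-+ b (a *ℕ b) ⟩
  ℕtoℚ b + ℕtoℚ (a *ℕ b)      ≡⟨ cong (ℕtoℚ b +_) (ℕtoℚ-* a b) ⟩
  ℕtoℚ b + ℕtoℚ a * ℕtoℚ b    ≡⟨ solve 2 (λ x y → y :+ x :* y := (con 1ℚ :+ x) :* y) refl (ℕtoℚ a) (ℕtoℚ b) ⟩
  (1ℚ + ℕtoℚ a) * ℕtoℚ b      ≡⟨ cong (_* ℕtoℚ b) (ℕtoℚ-suc a) ⟨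
  ℕtoℚ (suc a) * ℕtoℚ b       ∎
  where open ≡-Reasoning

ℕtoℚ*inv≡1 : ∀ m → m ≢ 0 → ℕtoℚ m * inv m ≡ 1ℚ
ℕtoℚ*inv≡1 zero    m≢0 = ⊥-elim (m≢0 refl)
ℕtoℚ*inv≡1 (suc m) _ rewrite ℕtoℚ≡mkℚ (suc m) | inv≡mkℚ m =
  ℚ.*-inverseʳ (mkℚ (+ℤ suc m) 0 (coprime-sym (1-coprimeTo (suc m))))

ℕtoℚ*inv-cong : ∀ a b c d → a *ℕ d ≡ c *ℕ b → b ≢ 0 → d ≢ 0 →
                ℕtoℚ a * inv b ≡ ℕtoℚ c * inv d
ℕtoℚ*inv-cong a b c d ad≡cb b≢0 d≢0 = begin
  qa * 1/qb                   ≡⟨ ℚ.*-identityʳ (qa * 1/qb) ⟨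
  qa * 1/qb * 1ℚ              ≡⟨ cong (qa * 1/qb *_) (ℕtoℚ*inv≡1 d d≢0) ⟨
  qa * 1/qb * (qd * 1/qd)     ≡⟨ solve 4 (λ qa 1/qb qd 1/qd → qa :* 1/qb :* (qd :* 1/qd) := qa :* qd :* 1/qb :* 1/qd) refl qa 1/qb qd 1/qd ⟩
  qa * qd * 1/qb * 1/qd       ≡⟨ cong (λ z → z * 1/qb * 1/qd) (ℕtoℚ-* a d) ⟨
  ℕtoℚ (a *ℕ d) * 1/qb * 1/qd ≡⟨ cong (λ z → ℕtoℚ z * 1/qb * 1/qd) ad≡cb ⟩
  ℕtoℚ (c *ℕ b) * 1/qb * 1/qd ≡⟨ cong (λ z → z * 1/qb * 1/qd) (ℕtoℚ-* c b) ⟩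
  qc * qb * 1/qb * 1/qd       ≡⟨ solve 4 (λ qc qb 1/qb 1/qd → qc :* qb :* 1/qb :* 1/qd := qc :* 1/qd :* (qb :* 1/qb)) refl qc qb 1/qb 1/qd ⟩
  qc * 1/qd * (qb * 1/qb)     ≡⟨ cong (qc * 1/qd *_) (ℕtoℚ*inv≡1 b b≢0) ⟩
  qc * 1/qd * 1ℚ              ≡⟨ ℚ.*-identityʳ (qc * 1/qd) ⟩
  qc * 1/qd                   ∎
  where
  open ≡-Reasoning
  qa = ℕtoℚ a
  qb = ℕtoℚ b
  qc = ℕtoℚ c
  qd = ℕtoℚ d
  1/qb = inv b
  1/qd = inv d

sumTo : (ℕ → ℚ) → ℕ → ℚ
sumTo f zero    = 0ℚ
sumTo f (suc k) = sumTo f k + f k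

sumTo-cong : ∀ {f g} k → (∀ i → f i ≡ g i) → sumTo f k ≡ sumTo g k
sumTo-cong zero    f≗g = refl
sumTo-cong (suc k) f≗g = cong₂ _+_ (sumTo-cong k f≗g) (f≗g k)

sumTo-suc-head : ∀ f k → sumTo f (suc k) ≡ f 0 + sumTo (λ i → f (suc i)) k
sumTo-suc-head f zero    = trans (ℚ.+-identityˡ (f 0)) (sym (ℚ.+-identityʳ (f 0)))
sumTo-suc-head f (suc k) = begin
  sumTo f (suc k) + f (suc k)                          ≡⟨ cong (_+ f (suc k)) (sumTo-suc-head f k) ⟩
  f 0 + sumTo (λ i → f (suc i)) k + f (suc k)          ≡⟨ ℚ.+-assoc (f 0) _ (f (suc k)) ⟩
  f 0 + (sumTo (λ i → f (suc i)) k + f (suc k))        ∎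
  where open ≡-Reasoning

sumTo-+ : ∀ f g k → sumTo (λ i → f i + g i) k ≡ sumTo f k + sumTo g k
sumTo-+ f g zero    = sym (ℚ.+-identityˡ 0ℚ)
sumTo-+ f g (suc k) = begin
  sumTo (λ i → f i + g i) k + (f k + g k)     ≡⟨ cong (_+ (f k + g k)) (sumTo-+ f g k) ⟩
  sumTo f k + sumTo g k + (f k + g k)
    ≡⟨ solve 4 (λ a b c d → a :+ b :+ (c :+ d) := a :+ c :+ (b :+ d)) refl (sumTo f k) (sumTo g k) (f k) (g k) ⟩
  sumTo f k + f k + (sumTo g k + g k)         ∎
  where open ≡-Reasoning

Σℚ-map-applyUpTo : ∀ (f : ℕ → ℚ) (g : ℕ → ℕ) k → Σℚ (map f (applyUpTo g k)) ≡ sumTo (λ i → f (g i)) k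
Σℚ-map-applyUpTo f g zero    = refl
Σℚ-map-applyUpTo f g (suc k) = trans
  (cong (f (g 0) +_) (Σℚ-map-applyUpTo f (λ i → g (suc i)) k))
  (sym (sumTo-suc-head (λ i → f (g i)) k))

Σℚ-map-upTo : ∀ f k → Σℚ (map f (upTo k)) ≡ sumTo f k
Σℚ-map-upTo f = Σℚ-map-applyUpTo f (λ i → i)

Σℚ-map-* : ∀ {A : Set} c (f : A → ℚ) l → Σℚ (map (λ a → c * f a) l) ≡ c * Σℚ (map f l)
Σℚ-map-* c f []      = sym (ℚ.*-zeroʳ c)
Σℚ-map-* c f (a ∷ l) = trans (cong (c * f a +_) (Σℚ-map-* c f l)) (sym (ℚ.*-distribˡ-+ c (f a) _))

Σℚ-map-- : ∀ {A : Set} (f g : A → ℚ) l → Σℚ (map (λ a → f a - g a) l) ≡ Σℚ (map f l) - Σℚ (map g l)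
Σℚ-map-- f g []      = refl
Σℚ-map-- f g (a ∷ l) = trans (cong (f a - g a +_) (Σℚ-map-- f g l))
  (solve 4 (λ x y s t → x :- y :+ (s :- t) := x :+ s :- (y :+ t)) refl (f a) (g a) (Σℚ (map f l)) (Σℚ (map g l)))

map-allFin-suc : ∀ {A : Set} n (g : Fin (suc n) → A) →
                 map g (allFin (suc n)) ≡ g fzero ∷ map (λ i → g (fsuc i)) (allFin n)
map-allFin-suc n g = cong (g fzero ∷_)
  (trans (List.map-tabulate fsuc g) (sym (List.map-tabulate (λ i → i) (λ i → g (fsuc i)))))

-- Binomial coefficients

C-suc-suc : ∀ n k → suc n C suc k ≡ n C k +ℕ n C suc k
C-suc-suc n k = sym (nCk+nC[k+1]≡[n+1]C[k+1] n k)

C≢0 : ∀ {n k} → k ≤ n → n C k ≢ 0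
C≢0 {n}     {zero}  _         ()
C≢0 {suc n} {suc k} (s≤s k≤n) e rewrite C-suc-suc n k = C≢0 k≤n (ℕ.m+n≡0⇒m≡0 (n C k) e)

sumTo-nC≡2^n : ∀ n → sumTo (λ i → ℕtoℚ (n C i)) (suc n) ≡ ℕtoℚ (2 ^ n)
sumTo-nC≡2^n zero    = ℚ.+-identityˡ 1ℚ
sumTo-nC≡2^n (suc n) = begin
  sumTo (λ i → ℕtoℚ (suc n C i)) (2 +ℕ n)
    ≡⟨ sumTo-suc-head (λ i → ℕtoℚ (suc n C i)) (suc n) ⟩
  1ℚ + sumTo (λ i → ℕtoℚ (suc n C suc i)) (suc n)
    ≡⟨ cong (1ℚ +_) (sumTo-cong (suc n) (λ i → trans (cong ℕtoℚ (C-suc-suc n i)) (ℕtoℚ-+ (n C i) _))) ⟩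
  1ℚ + sumTo (λ i → ℕtoℚ (n C i) + ℕtoℚ (n C suc i)) (suc n)
    ≡⟨ cong (1ℚ +_) (sumTo-+ (λ i → ℕtoℚ (n C i)) (λ i → ℕtoℚ (n C suc i)) (suc n)) ⟩
  1ℚ + (lower + (tail + top))
    ≡⟨ solve 4 (λ x y z w → x :+ (y :+ (z :+ w)) := y :+ (x :+ z) :+ w) refl 1ℚ lower tail top ⟩
  lower + (1ℚ + tail) + top
    ≡⟨ cong (λ z → lower + z + top) (sumTo-suc-head (λ i → ℕtoℚ (n C i)) n) ⟨
  lower + lower + top
    ≡⟨ cong (λ z → z + z + top) (sumTo-nC≡2^n n) ⟩
  ℕtoℚ (2 ^ n) + ℕtoℚ (2 ^ n) + top
    ≡⟨ cong (λ z → ℕtoℚ (2 ^ n) + ℕtoℚ (2 ^ n) + ℕtoℚ z) (k>n⇒nCk≡0 (ℕ.n<1+n n)) ⟩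
  ℕtoℚ (2 ^ n) + ℕtoℚ (2 ^ n) + 0ℚ
    ≡⟨ ℚ.+-identityʳ _ ⟩
  ℕtoℚ (2 ^ n) + ℕtoℚ (2 ^ n)
    ≡⟨ cong (ℕtoℚ (2 ^ n) +_) (cong ℕtoℚ (ℕ.+-identityʳ (2 ^ n))) ⟨
  ℕtoℚ (2 ^ n) + ℕtoℚ (2 ^ n +ℕ 0)
    ≡⟨ ℕtoℚ-+ (2 ^ n) (2 ^ n +ℕ 0) ⟨
  ℕtoℚ (2 ^ suc n) ∎
  where
  open ≡-Reasoning
  lower = sumTo (λ i → ℕtoℚ (n C i)) (suc n)
  tail = sumTo (λ i → ℕtoℚ (n C suc i)) n
  top = ℕtoℚ (n C suc n)

[1+k]*[1+n]C[1+k]≡[1+n]*nCk : ∀ n k → suc k *ℕ (suc n C suc k) ≡ suc n *ℕ (n C k)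
[1+k]*[1+n]C[1+k]≡[1+n]*nCk zero zero = refl
[1+k]*[1+n]C[1+k]≡[1+n]*nCk zero (suc k)
  rewrite k>n⇒nCk≡0 {1} {suc (suc k)} (s≤s (s≤s z≤n)) | k>n⇒nCk≡0 {0} {suc k} (s≤s z≤n) =
  ℕ.*-zeroʳ (suc (suc k))
[1+k]*[1+n]C[1+k]≡[1+n]*nCk (suc n) zero =
  trans (ℕ.+-identityʳ _) (trans (nC1≡n (suc (suc n))) (sym (ℕ.*-identityʳ (suc (suc n)))))
[1+k]*[1+n]C[1+k]≡[1+n]*nCk (suc n) (suc k) = begin
  (2 +ℕ k) *ℕ (suc N C suc (suc k))
    ≡⟨ cong ((2 +ℕ k) *ℕ_) (C-suc-suc N (suc k)) ⟩
  (2 +ℕ k) *ℕ (X +ℕ Y)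
    ≡⟨ regroup k X Y ⟩
  X +ℕ (suc k *ℕ X +ℕ (2 +ℕ k) *ℕ Y)
    ≡⟨ cong₂ (λ p q → X +ℕ (p +ℕ q)) ([1+k]*[1+n]C[1+k]≡[1+n]*nCk n k) ([1+k]*[1+n]C[1+k]≡[1+n]*nCk n (suc k)) ⟩
  X +ℕ (N *ℕ (n C k) +ℕ N *ℕ (n C suc k))
    ≡⟨ cong (X +ℕ_) (ℕ.*-distribˡ-+ N (n C k) (n C suc k)) ⟨
  X +ℕ N *ℕ (n C k +ℕ n C suc k)
    ≡⟨ cong (λ z → X +ℕ N *ℕ z) (C-suc-suc n k) ⟨
  X +ℕ N *ℕ X ∎
  where
  open ≡-Reasoning
  regroup : ∀ k X Y → (2 +ℕ k) *ℕ (X +ℕ Y) ≡ X +ℕ (suc k *ℕ X +ℕ (2 +ℕ k) *ℕ Y)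
  regroup = solve-∀
  N = suc n
  X = N C suc k
  Y = N C suc (suc k)

[1+n∸k]*[1+n]Ck≡[1+n]*nCk : ∀ {n k} → k ≤ n → (suc n ∸ k) *ℕ (suc n C k) ≡ suc n *ℕ (n C k)
[1+n∸k]*[1+n]Ck≡[1+n]*nCk {n} {zero}  _   = refl
[1+n∸k]*[1+n]Ck≡[1+n]*nCk {n} {suc j} j<n = ℕ.+-cancelʳ-≡ (suc n *ℕ (n C j)) _ _ (begin
  (n ∸ j) *ℕ X +ℕ suc n *ℕ (n C j)       ≡⟨ cong ((n ∸ j) *ℕ X +ℕ_) ([1+k]*[1+n]C[1+k]≡[1+n]*nCk n j) ⟨
  (n ∸ j) *ℕ X +ℕ suc j *ℕ X             ≡⟨ ℕ.*-distribʳ-+ X (n ∸ j) (suc j) ⟨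
  ((n ∸ j) +ℕ suc j) *ℕ X                ≡⟨ cong (_*ℕ X) (trans (ℕ.+-suc (n ∸ j) j) (cong suc (ℕ.m∸n+n≡m (ℕ.<⇒≤ j<n)))) ⟩
  suc n *ℕ X                             ≡⟨ cong (suc n *ℕ_) (C-suc-suc n j) ⟩
  suc n *ℕ (n C j +ℕ n C suc j)          ≡⟨ ℕ.*-distribˡ-+ (suc n) (n C j) (n C suc j) ⟩
  suc n *ℕ (n C j) +ℕ suc n *ℕ (n C suc j) ≡⟨ ℕ.+-comm (suc n *ℕ (n C j)) _ ⟩
  suc n *ℕ (n C suc j) +ℕ suc n *ℕ (n C j) ∎)
  where
  open ≡-Reasoning
  X = suc n C suc j

hamming-refl : ∀ {n} (u : Vertex n) → hamming u u ≡ 0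
hamming-refl []          = refl
hamming-refl (true ∷ u)  = hamming-refl u
hamming-refl (false ∷ u) = hamming-refl u

hamming-sym : ∀ {n} (u x : Vertex n) → hamming u x ≡ hamming x u
hamming-sym []          []          = refl
hamming-sym (true ∷ u)  (true ∷ x)  = hamming-sym u x
hamming-sym (true ∷ u)  (false ∷ x) = cong suc (hamming-sym u x)
hamming-sym (false ∷ u) (true ∷ x)  = cong suc (hamming-sym u x)
hamming-sym (false ∷ u) (false ∷ x) = hamming-sym u x

hamming≤n : ∀ {n} (u x : Vertex n) → hamming u x ≤ n
hamming≤n []          []          = z≤n
hamming≤n (true ∷ u)  (true ∷ x)  = ℕ.m≤n⇒m≤1+n (hamming≤n u x)
hamming≤n (true ∷ u)  (false ∷ x) = s≤s (hamming≤n u x)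
hamming≤n (false ∷ u) (true ∷ x)  = s≤s (hamming≤n u x)
hamming≤n (false ∷ u) (false ∷ x) = ℕ.m≤n⇒m≤1+n (hamming≤n u x)

hamming≡0⇒≡ : ∀ {n} (u x : Vertex n) → hamming u x ≡ 0 → u ≡ x
hamming≡0⇒≡ []          []          _ = refl
hamming≡0⇒≡ (true ∷ u)  (true ∷ x)  e = cong (true ∷_) (hamming≡0⇒≡ u x e)
hamming≡0⇒≡ (true ∷ u)  (false ∷ x) ()
hamming≡0⇒≡ (false ∷ u) (true ∷ x)  ()
hamming≡0⇒≡ (false ∷ u) (false ∷ x) e = cong (false ∷_) (hamming≡0⇒≡ u x e)

δ₀ : ℕ → ℚ
δ₀ zero    = 1ℚ
δ₀ (suc _) = 0ℚ

δ≡δ₀∘hamming : ∀ {n} (u x : Vertex n) → δ u x ≡ δ₀ (hamming u x)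
δ≡δ₀∘hamming u x with ≡-dec Bool._≟_ u x | hamming u x in eq
... | yes refl | zero  = refl
... | yes refl | suc _ with () ← trans (sym eq) (hamming-refl u)
... | no u≢x   | zero  = ⊥-elim (u≢x (hamming≡0⇒≡ u x eq))
... | no _     | suc _ = refl

-- Radial functions

radialLaplacian : ℕ → (ℕ → ℚ) → ℕ → ℚ
radialLaplacian n F m = ℕtoℚ n * F m - (ℕtoℚ m * F (pred m) + ℕtoℚ (n ∸ m) * F (suc m))

Σℚ-flipAt-radial : ∀ {n} (u x : Vertex n) (F : ℕ → ℚ) →
  Σℚ (map (λ i → F (hamming u (flipAt i x))) (allFin n)) ≡
  ℕtoℚ (hamming u x) * F (pred (hamming u x)) + ℕtoℚ (n ∸ hamming u x) * F (suc (hamming u x))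
Σℚ-flipAt-radial [] [] F = sym (trans (cong₂ _+_ (ℚ.*-zeroˡ (F 0)) (ℚ.*-zeroˡ (F 1))) (ℚ.+-identityˡ 0ℚ))
Σℚ-flipAt-radial {suc n} (a ∷ u) (b ∷ x) F =
  trans (cong Σℚ (map-allFin-suc n (λ i → F (hamming (a ∷ u) (flipAt i (b ∷ x))))))
        (by-first-coordinate a b)
  where
  open ≡-Reasoning
  m = hamming u x
  M = ℕtoℚ m
  D = ℕtoℚ (n ∸ m)

  flips-rest : ∀ e → Σℚ (map (λ i → F (e +ℕ hamming u (flipAt i x))) (allFin n)) ≡
               M * F (e +ℕ pred m) + D * F (e +ℕ suc m)
  flips-rest e = Σℚ-flipAt-radial u x (λ d → F (e +ℕ d))

  agreeing : F (suc m) + (M * F (pred m) + D * F (suc m)) ≡ M * F (pred m) + ℕtoℚ (suc n ∸ m) * F (suc m)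
  agreeing = begin
    F (suc m) + (M * F (pred m) + D * F (suc m))
      ≡⟨ solve 4 (λ s M p D → s :+ (M :* p :+ D :* s) := M :* p :+ (con 1ℚ :+ D) :* s) refl (F (suc m)) M (F (pred m)) D ⟩
    M * F (pred m) + (1ℚ + D) * F (suc m)
      ≡⟨ cong (λ z → M * F (pred m) + z * F (suc m)) (ℕtoℚ-suc (n ∸ m)) ⟨
    M * F (pred m) + ℕtoℚ (suc (n ∸ m)) * F (suc m)
      ≡⟨ cong (λ z → M * F (pred m) + ℕtoℚ z * F (suc m)) (ℕ.+-∸-assoc 1 (hamming≤n u x)) ⟨
    M * F (pred m) + ℕtoℚ (suc n ∸ m) * F (suc m) ∎

  differing : F m + (M * F (suc (pred m)) + D * F (2 +ℕ m)) ≡ ℕtoℚ (suc m) * F m + D * F (2 +ℕ m)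
  differing = begin
    F m + (M * F (suc (pred m)) + D * F (2 +ℕ m))
      ≡⟨ cong (λ z → F m + (z + D * F (2 +ℕ m))) (pred-cancel m) ⟩
    F m + (M * F m + D * F (2 +ℕ m))
      ≡⟨ solve 4 (λ f M D g → f :+ (M :* f :+ D :* g) := (con 1ℚ :+ M) :* f :+ D :* g) refl (F m) M D (F (2 +ℕ m)) ⟩
    (1ℚ + M) * F m + D * F (2 +ℕ m)
      ≡⟨ cong (λ z → z * F m + D * F (2 +ℕ m)) (ℕtoℚ-suc m) ⟨
    ℕtoℚ (suc m) * F m + D * F (2 +ℕ m) ∎
    where
    pred-cancel : ∀ k → ℕtoℚ k * F (suc (pred k)) ≡ ℕtoℚ k * F k
    pred-cancel zero    = trans (ℚ.*-zeroˡ (F 1)) (sym (ℚ.*-zeroˡ (F 0)))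
    pred-cancel (suc k) = refl

  by-first-coordinate : ∀ a b →
    F (hamming (a ∷ u) (not b ∷ x)) + Σℚ (map (λ i → F (hamming (a ∷ u) (b ∷ flipAt i x))) (allFin n)) ≡
    ℕtoℚ (hamming (a ∷ u) (b ∷ x)) * F (pred (hamming (a ∷ u) (b ∷ x))) +
    ℕtoℚ (suc n ∸ hamming (a ∷ u) (b ∷ x)) * F (suc (hamming (a ∷ u) (b ∷ x)))
  by-first-coordinate true  true  = trans (cong (F (suc m) +_) (flips-rest 0)) agreeing
  by-first-coordinate false false = trans (cong (F (suc m) +_) (flips-rest 0)) agreeing
  by-first-coordinate true  false = trans (cong (F m +_) (flips-rest 1)) differing
  by-first-coordinate false true  = trans (cong (F m +_) (flips-rest 1)) differing

laplacian-radial : ∀ {n} (u : Vertex n) (F : ℕ → ℚ) x →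
                   laplacian n (λ y → F (hamming u y)) x ≡ radialLaplacian n F (hamming u x)
laplacian-radial {n} u F x = cong (ℕtoℚ n * F (hamming u x) -_) (Σℚ-flipAt-radial u x F)

laplacian-* : ∀ n c (f : Vertex n → ℚ) x → laplacian n (λ y → c * f y) x ≡ c * laplacian n f x
laplacian-* n c f x = trans
  (cong (ℕtoℚ n * (c * f x) -_) (Σℚ-map-* c (λ i → f (flipAt i x)) (allFin n)))
  (solve 4 (λ N c y s → N :* (c :* y) :- c :* s := c :* (N :* y :- s)) refl (ℕtoℚ n) c (f x) _)

laplacian-- : ∀ n (f g : Vertex n → ℚ) x → laplacian n (λ y → f y - g y) x ≡ laplacian n f x - laplacian n g x
laplacian-- n f g x = trans
  (cong (ℕtoℚ n * (f x - g x) -_) (Σℚ-map-- (λ i → f (flipAt i x)) (λ i → g (flipAt i x)) (allFin n)))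
  (solve 5 (λ N y z s t → N :* (y :- z) :- (s :- t) := N :* y :- s :- (N :* z :- t)) refl (ℕtoℚ n) (f x) (g x) _ _)

-- The radial potential

binomialTail : ℕ → ℕ → ℚ
binomialTail n j = Σℚ (map (λ t → ℕtoℚ (n C (suc j +ℕ t))) (upTo (n ∸ j)))

increment : ℕ → ℕ → ℚ
increment n j = inv ((n ∸ 1) C j) * inv (2 ^ n) * binomialTail n j

radialPotential : ℕ → ℕ → ℚ
radialPotential n = sumTo (increment n)

formula≡radialPotential : ∀ n k → formula n k ≡ ℕtoℚ 2 * inv n * radialPotential n k
formula≡radialPotential n k = cong (ℕtoℚ 2 * inv n *_) (Σℚ-map-upTo (increment n) k)

binomialTail-zero : ∀ n → binomialTail n 0 ≡ ℕtoℚ (2 ^ n) - 1ℚ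
binomialTail-zero n = begin
  binomialTail n 0      ≡⟨ Σℚ-map-upTo (λ t → ℕtoℚ (n C suc t)) n ⟩
  tail                  ≡⟨ solve 1 (λ s → s := con 1ℚ :+ s :- con 1ℚ) refl tail ⟩
  1ℚ + tail - 1ℚ        ≡⟨ cong (_- 1ℚ) (sumTo-suc-head (λ i → ℕtoℚ (n C i)) n) ⟨
  sumTo (λ i → ℕtoℚ (n C i)) (suc n) - 1ℚ ≡⟨ cong (_- 1ℚ) (sumTo-nC≡2^n n) ⟩
  ℕtoℚ (2 ^ n) - 1ℚ     ∎
  where
  open ≡-Reasoning
  tail = sumTo (λ t → ℕtoℚ (n C suc t)) n

binomialTail-suc : ∀ {n j} → j < n → binomialTail n j ≡ ℕtoℚ (n C suc j) + binomialTail n (suc j)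
binomialTail-suc {n} {j} j<n = begin
  binomialTail n j
    ≡⟨ Σℚ-map-upTo term (n ∸ j) ⟩
  sumTo term (n ∸ j)
    ≡⟨ cong (sumTo term) (ℕ.+-∸-assoc 1 j<n) ⟩
  sumTo term (suc (n ∸ suc j))
    ≡⟨ sumTo-suc-head term (n ∸ suc j) ⟩
  term 0 + sumTo (λ t → term (suc t)) (n ∸ suc j)
    ≡⟨ cong₂ _+_ (cong (λ i → ℕtoℚ (n C suc i)) (ℕ.+-identityʳ j))
                 (sumTo-cong (n ∸ suc j) (λ t → cong (λ i → ℕtoℚ (n C suc i)) (ℕ.+-suc j t))) ⟩
  ℕtoℚ (n C suc j) + sumTo (λ t → ℕtoℚ (n C (2 +ℕ j +ℕ t))) (n ∸ suc j)
    ≡⟨ cong (ℕtoℚ (n C suc j) +_) (Σℚ-map-upTo (λ t → ℕtoℚ (n C (2 +ℕ j +ℕ t))) (n ∸ suc j)) ⟨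
  ℕtoℚ (n C suc j) + binomialTail n (suc j) ∎
  where
  open ≡-Reasoning
  term = λ t → ℕtoℚ (n C (suc j +ℕ t))

binomialTail-self : ∀ n → binomialTail n n ≡ 0ℚ
binomialTail-self n = cong (λ k → Σℚ (map (λ t → ℕtoℚ (n C (suc n +ℕ t))) (upTo k))) (ℕ.n∸n≡0 n)

radialLaplacian-sumTo-zero : ∀ n f → radialLaplacian n (sumTo f) 0 ≡ ℕtoℚ n * (0ℚ - f 0)
radialLaplacian-sumTo-zero n f =
  solve 3 (λ N z a → N :* con 0ℚ :- (z :* con 0ℚ :+ N :* (con 0ℚ :+ a)) := N :* (con 0ℚ :- a))
    refl (ℕtoℚ n) (ℕtoℚ 0) (f 0)

radialLaplacian-sumTo-suc : ∀ {n m} f → suc m ≤ n →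
  radialLaplacian n (sumTo f) (suc m) ≡ ℕtoℚ (suc m) * f m - ℕtoℚ (n ∸ suc m) * f (suc m)
radialLaplacian-sumTo-suc {n} {m} f m<n = begin
  ℕtoℚ n * (P + a) - (M * P + D * (P + a + b))
    ≡⟨ cong (λ z → z * (P + a) - (M * P + D * (P + a + b))) n≡M+D ⟩
  (M + D) * (P + a) - (M * P + D * (P + a + b))
    ≡⟨ solve 5 (λ M D P a b → (M :+ D) :* (P :+ a) :- (M :* P :+ D :* (P :+ a :+ b)) := M :* a :- D :* b) refl M D P a b ⟩
  M * a - D * b ∎
  where
  open ≡-Reasoning
  P = sumTo f m
  a = f m
  b = f (suc m)
  M = ℕtoℚ (suc m)
  D = ℕtoℚ (n ∸ suc m)
  n≡M+D : ℕtoℚ n ≡ M + D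
  n≡M+D = trans (cong ℕtoℚ (sym (ℕ.m+[n∸m]≡n m<n))) (ℕtoℚ-+ (suc m) (n ∸ suc m))

scaled-increment : ∀ a c d n j → a *ℕ d ≡ c *ℕ ((n ∸ 1) C j) → (n ∸ 1) C j ≢ 0 → d ≢ 0 →
  ℕtoℚ a * increment n j ≡ ℕtoℚ c * inv d * inv (2 ^ n) * binomialTail n j
scaled-increment a c d n j ad≡cb b≢0 d≢0 = trans
  (solve 4 (λ x y w s → x :* (y :* w :* s) := x :* y :* w :* s) refl (ℕtoℚ a) (inv ((n ∸ 1) C j)) (inv (2 ^ n)) (binomialTail n j))
  (cong (λ z → z * inv (2 ^ n) * binomialTail n j) (ℕtoℚ*inv-cong a ((n ∸ 1) C j) c d ad≡cb b≢0 d≢0))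

[1+j]*increment : ∀ {n j} → j ≤ n →
  ℕtoℚ (suc j) * increment (suc n) j ≡ ℕtoℚ (suc n) * inv (suc n C suc j) * inv (2 ^ suc n) * binomialTail (suc n) j
[1+j]*increment {n} {j} j≤n =
  scaled-increment (suc j) (suc n) (suc n C suc j) (suc n) j ([1+k]*[1+n]C[1+k]≡[1+n]*nCk n j) (C≢0 j≤n) (C≢0 (s≤s j≤n))

[n∸m]*increment : ∀ {n m} → m ≤ n →
  ℕtoℚ (n ∸ m) * increment n m ≡ ℕtoℚ n * inv (n C m) * inv (2 ^ n) * binomialTail n m
[n∸m]*increment {n} {m} m≤n with ℕ.m≤n⇒m<n∨m≡n m≤n
... | inj₁ (s≤s m≤n-1) = scaled-increment (n ∸ m) n (n C m) n m ([1+n∸k]*[1+n]Ck≡[1+n]*nCk m≤n-1) (C≢0 m≤n-1) (C≢0 m≤n)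
... | inj₂ refl = begin
  ℕtoℚ (n ∸ n) * increment n n          ≡⟨ cong (λ k → ℕtoℚ k * increment n n) (ℕ.n∸n≡0 n) ⟩
  0ℚ * increment n n                     ≡⟨ ℚ.*-zeroˡ (increment n n) ⟩
  0ℚ                                     ≡⟨ ℚ.*-zeroʳ (ℕtoℚ n * inv (n C n) * inv (2 ^ n)) ⟨
  ℕtoℚ n * inv (n C n) * inv (2 ^ n) * 0ℚ ≡⟨ cong (ℕtoℚ n * inv (n C n) * inv (2 ^ n) *_) (binomialTail-self n) ⟨
  ℕtoℚ n * inv (n C n) * inv (2 ^ n) * binomialTail n n ∎
  where open ≡-Reasoning

2^n≢0 : ∀ n → 2 ^ n ≢ 0
2^n≢0 n = ≢-nonZero⁻¹ (2 ^ n) {{ℕ.m^n≢0 2 n}}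

radialLaplacian-radialPotential : ∀ n m → m ≤ suc n →
  radialLaplacian (suc n) (radialPotential (suc n)) m ≡ ℕtoℚ (suc n) * (inv (2 ^ suc n) - δ₀ m)
radialLaplacian-radialPotential n zero _ = begin
  radialLaplacian N (sumTo (increment N)) 0
    ≡⟨ radialLaplacian-sumTo-zero N (increment N) ⟩
  ℕtoℚ N * (0ℚ - 1ℚ * w * binomialTail N 0)
    ≡⟨ cong (λ z → ℕtoℚ N * (0ℚ - 1ℚ * w * z)) (binomialTail-zero N) ⟩
  ℕtoℚ N * (0ℚ - 1ℚ * w * (ℕtoℚ (2 ^ N) - 1ℚ))
    ≡⟨ solve 3 (λ N w T → N :* (con 0ℚ :- con 1ℚ :* w :* (T :- con 1ℚ)) := N :* (w :- T :* w)) refl (ℕtoℚ N) w (ℕtoℚ (2 ^ N)) ⟩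
  ℕtoℚ N * (w - ℕtoℚ (2 ^ N) * w)
    ≡⟨ cong (λ z → ℕtoℚ N * (w - z)) (ℕtoℚ*inv≡1 (2 ^ N) (2^n≢0 N)) ⟩
  ℕtoℚ N * (w - 1ℚ) ∎
  where
  open ≡-Reasoning
  N = suc n
  w = inv (2 ^ N)
radialLaplacian-radialPotential n (suc m) m<N = begin
  radialLaplacian N (sumTo (increment N)) (suc m)
    ≡⟨ radialLaplacian-sumTo-suc (increment N) m<N ⟩
  ℕtoℚ (suc m) * increment N m - ℕtoℚ (N ∸ suc m) * increment N (suc m)
    ≡⟨ cong₂ _-_ ([1+j]*increment (s≤s⁻¹ m<N)) ([n∸m]*increment m<N) ⟩
  K * binomialTail N m - K * binomialTail N (suc m)
    ≡⟨ cong (λ z → K * z - K * binomialTail N (suc m)) (binomialTail-suc m<N) ⟩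
  K * (ℕtoℚ (N C suc m) + binomialTail N (suc m)) - K * binomialTail N (suc m)
    ≡⟨ solve 5 (λ N c⁻¹ w c s → N :* c⁻¹ :* w :* (c :+ s) :- N :* c⁻¹ :* w :* s := N :* w :* (c :* c⁻¹))
         refl (ℕtoℚ N) (inv (N C suc m)) w (ℕtoℚ (N C suc m)) (binomialTail N (suc m)) ⟩
  ℕtoℚ N * w * (ℕtoℚ (N C suc m) * inv (N C suc m))
    ≡⟨ cong (ℕtoℚ N * w *_) (ℕtoℚ*inv≡1 (N C suc m) (C≢0 m<N)) ⟩
  ℕtoℚ N * w * 1ℚ
    ≡⟨ solve 2 (λ N w → N :* w :* con 1ℚ := N :* (w :- con 0ℚ)) refl (ℕtoℚ N) w ⟩
  ℕtoℚ N * (w - 0ℚ) ∎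
  where
  open ≡-Reasoning
  N = suc n
  w = inv (2 ^ N)
  K = ℕtoℚ N * inv (N C suc m) * w

radialUnitPotential : ∀ n → Vertex n → Vertex n → Vertex n → ℚ
radialUnitPotential n u v x = inv n * (radialPotential n (hamming v x) - radialPotential n (hamming u x))

radialUnitPotential-isUnitPotential : ∀ n (u v : Vertex (suc n)) → IsUnitPotential (suc n) u v (radialUnitPotential (suc n) u v)
radialUnitPotential-isUnitPotential n u v x = begin
  laplacian N (λ y → inv N * (P (hamming v y) - P (hamming u y))) x
    ≡⟨ laplacian-* N (inv N) (λ y → P (hamming v y) - P (hamming u y)) x ⟩
  inv N * laplacian N (λ y → P (hamming v y) - P (hamming u y)) x
    ≡⟨ cong (inv N *_) (laplacian-- N (λ y → P (hamming v y)) (λ y → P (hamming u y)) x) ⟩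
  inv N * (laplacian N (λ y → P (hamming v y)) x - laplacian N (λ y → P (hamming u y)) x)
    ≡⟨ cong (inv N *_) (cong₂ _-_ (radial v) (radial u)) ⟩
  inv N * (ℕtoℚ N * (w - δ₀ (hamming v x)) - ℕtoℚ N * (w - δ₀ (hamming u x)))
    ≡⟨ solve 5 (λ c N w a b → c :* (N :* (w :- a) :- N :* (w :- b)) := N :* c :* (b :- a))
         refl (inv N) (ℕtoℚ N) w (δ₀ (hamming v x)) (δ₀ (hamming u x)) ⟩
  ℕtoℚ N * inv N * (δ₀ (hamming u x) - δ₀ (hamming v x))
    ≡⟨ cong (_* (δ₀ (hamming u x) - δ₀ (hamming v x))) (ℕtoℚ*inv≡1 N λ ()) ⟩
  1ℚ * (δ₀ (hamming u x) - δ₀ (hamming v x))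
    ≡⟨ ℚ.*-identityˡ _ ⟩
  δ₀ (hamming u x) - δ₀ (hamming v x)
    ≡⟨ cong₂ _-_ (δ≡δ₀∘hamming u x) (δ≡δ₀∘hamming v x) ⟨
  δ u x - δ v x ∎
  where
  open ≡-Reasoning
  N = suc n
  P = radialPotential N
  w = inv (2 ^ N)
  radial : ∀ y → laplacian N (λ z → P (hamming y z)) x ≡ ℕtoℚ N * (w - δ₀ (hamming y x))
  radial y = trans (laplacian-radial y P x) (radialLaplacian-radialPotential n (hamming y x) (hamming≤n y x))

radialUnitPotential-drop : ∀ n (u v : Vertex n) → radialUnitPotential n u v u - radialUnitPotential n u v v ≡ formula n (hamming u v)
radialUnitPotential-drop n u v rewrite hamming-sym v u | hamming-refl u | hamming-refl v = trans
  (solve 2 (λ c p → c :* (p :- con 0ℚ) :- c :* (con 0ℚ :- p) := con (ℕtoℚ 2) :* c :* p) refl (inv n) (radialPotential n (hamming u v)))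
  (sym (formula≡radialPotential n (hamming u v)))

-- Maximum principle

Harmonic : ∀ n → (Vertex n → ℚ) → Set
Harmonic n h = ∀ x → laplacian n h x ≡ 0ℚ

maximum : ∀ n (h : Vertex n → ℚ) → Σ[ x ∈ Vertex n ] (∀ y → h y ≤ℚ h x)
maximum zero    h = [] , λ { [] → ℚ.≤-refl }
maximum (suc n) h with maximum n (λ y → h (true ∷ y)) | maximum n (λ y → h (false ∷ y))
... | x , x-max | x′ , x′-max with ℚ.≤-total (h (true ∷ x)) (h (false ∷ x′))
...   | inj₁ ≤x′ = false ∷ x′ , λ { (true ∷ y) → ℚ.≤-trans (x-max y) ≤x′ ; (false ∷ y) → x′-max y }
...   | inj₂ ≤x  = true ∷ x   , λ { (true ∷ y) → x-max y ; (false ∷ y) → ℚ.≤-trans (x′-max y) ≤x }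

flipAt-closed⇒universal : ∀ n (Q : Vertex n → Set) → (∀ z i → Q z → Q (flipAt i z)) → ∀ x y → Q x → Q y
flipAt-closed⇒universal zero    Q closed [] [] q = q
flipAt-closed⇒universal (suc n) Q closed (a ∷ x) (b ∷ y) q =
  set-first a b (flipAt-closed⇒universal n (λ z → Q (a ∷ z)) (λ z i → closed (a ∷ z) (fsuc i)) x y q)
  where
  set-first : ∀ a b → Q (a ∷ y) → Q (b ∷ y)
  set-first true  true  q = q
  set-first false false q = q
  set-first true  false q = closed (true ∷ y) fzero q
  set-first false true  q = closed (false ∷ y) fzero q

Σℚ-allFin-≤ : ∀ n (g : Fin n → ℚ) M → (∀ i → g i ≤ℚ M) → Σℚ (map g (allFin n)) ≤ℚ ℕtoℚ n * M
Σℚ-allFin-≤ zero    g M g≤M = ℚ.≤-reflexive (sym (ℚ.*-zeroˡ M))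
Σℚ-allFin-≤ (suc n) g M g≤M = begin
  Σℚ (map g (allFin (suc n)))
    ≡⟨ cong Σℚ (map-allFin-suc n g) ⟩
  g fzero + Σℚ (map (λ i → g (fsuc i)) (allFin n))
    ≤⟨ ℚ.+-mono-≤ (g≤M fzero) (Σℚ-allFin-≤ n (λ i → g (fsuc i)) M (λ i → g≤M (fsuc i))) ⟩
  M + ℕtoℚ n * M
    ≡⟨ solve 2 (λ M k → M :+ k :* M := (con 1ℚ :+ k) :* M) refl M (ℕtoℚ n) ⟩
  (1ℚ + ℕtoℚ n) * M
    ≡⟨ cong (_* M) (ℕtoℚ-suc n) ⟨
  ℕtoℚ (suc n) * M ∎
  where open ℚ.≤-Reasoning

Σℚ-allFin-≡-max : ∀ n (g : Fin n → ℚ) M → (∀ i → g i ≤ℚ M) →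
                  Σℚ (map g (allFin n)) ≡ ℕtoℚ n * M → ∀ i → g i ≡ M
Σℚ-allFin-≡-max (suc n) g M g≤M sum≡ = at
  where
  rest = Σℚ (map (λ i → g (fsuc i)) (allFin n))
  rest≤ = Σℚ-allFin-≤ n (λ i → g (fsuc i)) M (λ i → g≤M (fsuc i))
  split : g fzero + rest ≡ M + ℕtoℚ n * M
  split = trans (sym (cong Σℚ (map-allFin-suc n g))) (trans sum≡
    (trans (cong (_* M) (ℕtoℚ-suc n)) (solve 2 (λ M k → (con 1ℚ :+ k) :* M := M :+ k :* M) refl M (ℕtoℚ n))))
  head≡ : g fzero ≡ M
  head≡ = ℚ.≤-antisym (g≤M fzero) (ℚ.≮⇒≥ λ g₀<M →
    ℚ.<-irrefl refl (ℚ.<-≤-trans (ℚ.+-mono-<-≤ g₀<M rest≤) (ℚ.≤-reflexive (sym split))))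
  rest≡ : rest ≡ ℕtoℚ n * M
  rest≡ = begin
    rest                       ≡⟨ solve 2 (λ g s → s := g :+ s :- g) refl (g fzero) rest ⟩
    g fzero + rest - g fzero   ≡⟨ cong₂ _-_ split head≡ ⟩
    M + ℕtoℚ n * M - M         ≡⟨ solve 2 (λ M k → M :+ k :* M :- M := k :* M) refl M (ℕtoℚ n) ⟩
    ℕtoℚ n * M                 ∎
    where open ≡-Reasoning
  at : ∀ i → g i ≡ M
  at fzero    = head≡
  at (fsuc i) = Σℚ-allFin-≡-max n (λ i → g (fsuc i)) M (λ i → g≤M (fsuc i)) rest≡ i

harmonic-constant : ∀ n (h : Vertex n → ℚ) → Harmonic n h → ∀ x y → h x ≡ h y
harmonic-constant n h harmonic x y = trans (attains-max x) (sym (attains-max y))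
  where
  xₘ = proj₁ (maximum n h)
  ≤max = proj₂ (maximum n h)
  spreads : ∀ z i → h z ≡ h xₘ → h (flipAt i z) ≡ h xₘ
  spreads z i z-max = Σℚ-allFin-≡-max n (λ j → h (flipAt j z)) (h xₘ) (λ j → ≤max (flipAt j z))
    (trans (sym (x∙y⁻¹≈ε⇒x≈y ℚ.+-0-group _ _ (harmonic z))) (cong (ℕtoℚ n *_) z-max)) i
  attains-max : ∀ y → h y ≡ h xₘ
  attains-max y = flipAt-closed⇒universal n (λ z → h z ≡ h xₘ) spreads xₘ y refl

unitPotential-drop-unique : ∀ {n u v φ ψ} → IsUnitPotential n u v φ → IsUnitPotential n u v ψ →
                            φ u - φ v ≡ ψ u - ψ v
unitPotential-drop-unique {n} {u} {v} {φ} {ψ} φ-unit ψ-unit = begin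
  φ u - φ v                       ≡⟨ solve 3 (λ a b c → a :- b := a :- c :+ (c :- b)) refl (φ u) (φ v) (ψ u) ⟩
  φ u - ψ u + (ψ u - φ v)         ≡⟨ cong (_+ (ψ u - φ v)) (harmonic-constant n (λ x → φ x - ψ x) difference-harmonic u v) ⟩
  φ v - ψ v + (ψ u - φ v)         ≡⟨ solve 3 (λ a b c → a :- b :+ (c :- a) := c :- b) refl (φ v) (ψ v) (ψ u) ⟩
  ψ u - ψ v                       ∎
  where
  open ≡-Reasoning
  difference-harmonic : Harmonic n (λ x → φ x - ψ x)
  difference-harmonic x = trans (laplacian-- n φ ψ x)
    (trans (cong₂ _-_ (φ-unit x) (ψ-unit x)) (ℚ.+-inverseʳ (δ u x - δ v x)))

mainTheorem8 : (n : ℕ) → 1 ≤ n → (k : ℕ) → k ≤ n →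
    (u v : Vertex n) → hamming u v ≡ k → EffRes n u v (formula n k)
mainTheorem8 (suc n) _ _ _ u v refl =
  (radialUnitPotential (suc n) u v , radialUnitPotential-isUnitPotential n u v) ,
  λ φ φ-unit → trans (unitPotential-drop-unique φ-unit (radialUnitPotential-isUnitPotential n u v))
                     (radialUnitPotential-drop (suc n) u v)
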